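{- The independence number $\alpha$ of the graph $\Gamma(8,\{2,5\})$ satisfies $230\le\alpha\le240$.
   Context: $[8]=\{1,\dots,8\}$. Subsets $X,Y$ of $[8]$ are in general position if $X\cup Y=[8]$ or $X\cap Y=\emptyset$. The vertices of $\Gamma(8,\{2,5\})$ are the pairs $(A,B)$ with $A\subseteq B\subseteq[8]$, $|A|=2$, $|B|=5$, and $(A,B)$, $(A',B')$ are adjacent iff each of $A,B$ is in general position with each of $A',B'$. -}

module Defs where

open import Data.Nat using (ℕ)
open import Data.Product using (_×_; _,_; proj₁; proj₂)
open import Data.Sum using (_⊎_)
open import Data.Fin.Subset using (Subset; _∪_; _∩_; _⊆_; ∣_∣) renaming (⊤ to Full; ⊥ to Empty)
open import Data.List using (List; length)
open import Data.List.Membership.Propositional using (_∈_)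
open import Data.List.Relation.Unary.All using (All)
open import Data.List.Relation.Unary.Unique.Propositional using (Unique)
open import Relation.Binary.PropositionalEquality using (_≡_; _≢_)
open import Relation.Nullary using (¬_)

S8 : Set
S8 = Subset 8

GenPos : S8 → S8 → Set
GenPos X Y = (X ∪ Y ≡ Full) ⊎ (X ∩ Y ≡ Empty)

Pair : Set
Pair = S8 × S8

IsVertex : Pair → Set
IsVertex (A , B) = (A ⊆ B) × (∣ A ∣ ≡ 2) × (∣ B ∣ ≡ 5)

Adjacent : Pair → Pair → Set
Adjacent (A , B) (A' , B') =
  GenPos A A' × GenPos A B' × GenPos B A' × GenPos B B'

IsIndependent : List Pair → Set
IsIndependent S =
  All IsVertex S × Unique S ×
  (∀ {u v} → u ∈ S → v ∈ S → u ≢ v → ¬ Adjacent u v)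

-- An independent set contains no two consecutive vertices of a cycle, so it meets an odd
-- cycle of length 2k + 1 in at most k vertices.  The 560 vertices of Γ(8,{2,5}) are covered
-- by 80 seven-cycles, the orbits of 16 cycles under the rotation (1 2 3 4 5) of [8]; hence
-- an independent set has at most 80 · 3 = 240 vertices.  For the lower bound, an explicit
-- set of 230 vertices is checked to be independent.

module Submission where

open import Defs
open import Data.Bool using (T)
open import Data.Bool.ListAction using (all)
open import Data.Bool.Properties using () renaming (_≟_ to _≟ᵇ_)
open import Data.Digit using (toNatDigits)
open import Data.Empty using (⊥-elim)
open import Data.Fin using (toℕ)
open import Data.Fin.Subset using (Subset; inside; outside; _∪_; _∩_; ∣_∣) renaming (⊤ to Full; ⊥ to Empty)
open import Data.Fin.Subset.Properties using (_⊆?_; ∪-idem; ∩-idem)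
open import Data.List using (List; []; _∷_; [_]; _++_; length; filter; concat; concatMap; iterate; map; take; cartesianProduct)
open import Data.List.Membership.Propositional using (_∈_; _∉_)
import Data.List.Membership.DecPropositional as DecMembership
open import Data.List.Membership.Propositional.Properties using (∈-∃++; ∈-++⁻; ∈-++⁺ˡ; ∈-++⁺ʳ; ∈-map⁺; ∈-filter⁺; ∈-cartesianProduct⁺)
open import Data.List.Properties using (filter-++; filter-accept; length-++; length-++-sucʳ)
open import Data.List.Relation.Binary.Subset.Propositional using (_⊆_)
open import Data.List.Relation.Unary.All using (All; []; _∷_)
open import Data.List.Relation.Unary.All.Properties using (all⁺)
import Data.List.Relation.Unary.All as All
open import Data.List.Relation.Unary.AllPairs using ([]; _∷_)
open import Data.List.Relation.Unary.Any using (here; there; any?)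
open import Data.List.Relation.Unary.Linked using (Linked; []; [-]; _∷_; tail; linked?)
open import Data.List.Relation.Unary.Unique.Propositional using (Unique)
import Data.List.Relation.Unary.Unique.DecPropositional as DecUnique
open import Data.Nat using (ℕ; zero; suc; _+_; _*_; _≤_; z≤n; s≤s; _≟_; _≤?_; s≤s⁻¹)
open import Data.Nat.Properties using (+-comm; ≤-refl; ≤-trans; m≤n⇒m≤1+n; +-mono-≤; *-cancelʳ-<; module ≤-Reasoning)
open import Data.Product using (Σ; _×_; _,_)
open import Data.Product.Properties using () renaming (≡-dec to ×-≡-dec)
open import Data.Sum using (_⊎_; inj₁; inj₂)
open import Data.Vec using ([]; _∷_; tabulate)
open import Data.Vec.Properties using () renaming (≡-dec to Vec-≡-dec)
open import Function using (_∘_)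
open import Level using (_⊔_)
open import Relation.Binary using (Rel; Decidable; DecidableEquality)
open import Relation.Binary.PropositionalEquality using (_≡_; refl; sym; trans; cong; subst; subst₂; module ≡-Reasoning)
open import Relation.Nullary using (¬_; yes; no; does; ¬?)
open import Relation.Nullary.Decidable using (_×-dec_; _⊎-dec_; isYes; from-yes; toWitness)
open import Relation.Unary using (Pred) renaming (Decidable to Decidable₁)


Cycle : ∀ {a r} {A : Set a} → Rel A r → List A → Set (a ⊔ r)
Cycle _~_ xs = Linked _~_ (xs ++ take 1 xs)

linked-++⁻ˡ : ∀ {a r} {A : Set a} {R : Rel A r} (xs : List A) {ys : List A} →
              Linked R (xs ++ ys) → Linked R xs
linked-++⁻ˡ []           _        = []
linked-++⁻ˡ (x ∷ [])     _        = [-]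
linked-++⁻ˡ (x ∷ y ∷ xs) (r ∷ rs) = r ∷ linked-++⁻ˡ (y ∷ xs) rs

length-snoc : ∀ {a} {A : Set a} (xs : List A) {x : A} → length (xs ++ [ x ]) ≡ suc (length xs)
length-snoc xs = trans (length-++ xs) (+-comm (length xs) 1)

module OddCycles {a r p} {A : Set a} (_~_ : Rel A r) {P : Pred A p} (P? : Decidable₁ P)
                 (independent : ∀ {u v} → u ~ v → P u → ¬ P v) where

  count : List A → ℕ
  count xs = length (filter P? xs)

  count-++ : ∀ xs ys → count (xs ++ ys) ≡ count xs + count ys
  count-++ xs ys = trans (cong length (filter-++ P? xs ys)) (length-++ (filter P? xs))

  count-snoc : ∀ {x} xs → P x → count (xs ++ [ x ]) ≡ suc (count xs)
  count-snoc {x} xs px = begin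
    length (filter P? (xs ++ [ x ]))          ≡⟨ cong length (filter-++ P? xs [ x ]) ⟩
    length (filter P? xs ++ filter P? [ x ])  ≡⟨ cong (λ ys → length (filter P? xs ++ ys)) (filter-accept P? px) ⟩
    length (filter P? xs ++ [ x ])            ≡⟨ length-snoc (filter P? xs) ⟩
    suc (count xs)                            ∎
    where open ≡-Reasoning

  mutual
    count-path : ∀ {xs} → Linked _~_ xs → count xs * 2 ≤ suc (length xs)
    count-path []                 = z≤n
    count-path {x ∷ xs} path with P? x
    ... | yes px = s≤s (s≤s (count-path-from px path))
    ... | no  _  = m≤n⇒m≤1+n (count-path (tail path))

    count-path-from : ∀ {x xs} → P x → Linked _~_ (x ∷ xs) → count xs * 2 ≤ length xs
    count-path-from              _  [-]          = z≤n
    count-path-from {xs = y ∷ _} px (x~y ∷ path) with P? y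
    ... | yes py = ⊥-elim (independent x~y px py)
    ... | no  _  = count-path (tail path)

  count-cycle : ∀ {xs} → Cycle _~_ xs → count xs * 2 ≤ length xs
  count-cycle {[]}     _     = z≤n
  count-cycle {x ∷ xs} cycle with P? x
  ... | yes px = subst₂ _≤_ (cong (_* 2) (count-snoc xs px)) (length-snoc xs) (count-path-from px cycle)
  ... | no  _  = count-path (linked-++⁻ˡ xs (tail cycle))

  count-cycles : ∀ {k} {cs : List (List A)} → All (λ c → Cycle _~_ c × length c ≤ suc (k * 2)) cs →
                 count (concat cs) ≤ length cs * k
  count-cycles []                                    = z≤n
  count-cycles {k} {c ∷ cs} ((cycle , short) ∷ rest) = begin
    count (c ++ concat cs)       ≡⟨ count-++ c (concat cs) ⟩
    count c + count (concat cs)  ≤⟨ +-mono-≤ count-c≤k (count-cycles rest) ⟩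
    k + length cs * k            ∎
    where
    open ≤-Reasoning
    count-c≤k : count c ≤ k
    count-c≤k = s≤s⁻¹ (*-cancelʳ-< 2 (count c) (suc k) (s≤s (≤-trans (count-cycle {c} cycle) short)))

unique⊆⇒length≤ : ∀ {a} {A : Set a} {xs ys : List A} → Unique xs → xs ⊆ ys → length xs ≤ length ys
unique⊆⇒length≤ {xs = []}     _             _       = z≤n
unique⊆⇒length≤ {xs = x ∷ xs} (x∉xs ∷ uniq) x∷xs⊆ys
  with ys₁ , ys₂ , refl ← ∈-∃++ (x∷xs⊆ys (here refl)) =
  subst (suc (length xs) ≤_) (sym (length-++-sucʳ ys₁ x ys₂))
        (s≤s (unique⊆⇒length≤ uniq xs⊆ys₁++ys₂))
  where
  xs⊆ys₁++ys₂ : xs ⊆ ys₁ ++ ys₂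
  xs⊆ys₁++ys₂ {z} z∈xs with ∈-++⁻ ys₁ (x∷xs⊆ys (there z∈xs))
  ... | inj₁ z∈ys₁         = ∈-++⁺ˡ z∈ys₁
  ... | inj₂ (here refl)   = ⊥-elim (All.lookup x∉xs z∈xs refl)
  ... | inj₂ (there z∈ys₂) = ∈-++⁺ʳ ys₁ z∈ys₂

-- The large checks below go through the boolean `all`: evaluating `all?` instead retains
-- every intermediate `Dec` proof and exhausts memory.
all-isYes⇒All : ∀ {a p} {A : Set a} {P : Pred A p} (P? : Decidable₁ P) (xs : List A) →
               T (all (isYes ∘ P?) xs) → All P xs
all-isYes⇒All P? xs checked = All.map (λ {x} → toWitness {a? = P? x}) (all⁺ (isYes ∘ P?) xs checked)

allSubsets : ∀ n → List (Subset n)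
allSubsets zero    = [ [] ]
allSubsets (suc n) = map (inside ∷_) (allSubsets n) ++ map (outside ∷_) (allSubsets n)

∈-allSubsets : ∀ {n} (p : Subset n) → p ∈ allSubsets n
∈-allSubsets []            = here refl
∈-allSubsets (inside ∷ p)  = ∈-++⁺ˡ (∈-map⁺ (inside ∷_) (∈-allSubsets p))
∈-allSubsets (outside ∷ p) = ∈-++⁺ʳ _ (∈-map⁺ (outside ∷_) (∈-allSubsets p))

_≟ₛ_ : DecidableEquality S8
_≟ₛ_ = Vec-≡-dec _≟ᵇ_

_≟ₚ_ : DecidableEquality Pair
_≟ₚ_ = ×-≡-dec _≟ₛ_ _≟ₛ_

open DecMembership _≟ₚ_ using (_∈?_)
open DecUnique _≟ₚ_ using (unique?)

genPos? : Decidable GenPos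
genPos? X Y = ((X ∪ Y) ≟ₛ Full) ⊎-dec ((X ∩ Y) ≟ₛ Empty)

adjacent? : Decidable Adjacent
adjacent? (A , B) (A′ , B′) = genPos? A A′ ×-dec genPos? A B′ ×-dec genPos? B A′ ×-dec genPos? B B′

isVertex? : Decidable₁ IsVertex
isVertex? (A , B) = (A ⊆? B) ×-dec (∣ A ∣ ≟ 2) ×-dec (∣ B ∣ ≟ 5)

genPos-self : ∀ {X} → GenPos X X → X ≡ Full ⊎ X ≡ Empty
genPos-self {X} (inj₁ X∪X≡Full)  = inj₁ (trans (sym (∪-idem X)) X∪X≡Full)
genPos-self {X} (inj₂ X∩X≡Empty) = inj₂ (trans (sym (∩-idem X)) X∩X≡Empty)

adjacent-irrefl : ∀ {v} → IsVertex v → ¬ Adjacent v v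
adjacent-irrefl (_ , ∣A∣≡2 , _) (AA-genPos , _) with genPos-self AA-genPos | ∣A∣≡2
... | inj₁ refl | ()
... | inj₂ refl | ()

-- ⟨ a ∣ b ⟩ is the pair (A, B) whose elements are the decimal digits of a and b,
-- e.g. ⟨ 13 ∣ 12345 ⟩ = ({1,3}, {1,2,3,4,5}); the index i : Fin 8 stands for i + 1 ∈ [8].
digitSet : ℕ → S8
digitSet n = tabulate λ i → does (any? (suc (toℕ i) ≟_) (toNatDigits 10 n))

⟨_∣_⟩ : ℕ → ℕ → Pair
⟨ a ∣ b ⟩ = digitSet a , digitSet b

independentSet : List Pair
independentSet =
  ⟨ 13 ∣ 12345 ⟩ ∷ ⟨ 23 ∣ 12345 ⟩ ∷ ⟨ 34 ∣ 12345 ⟩ ∷ ⟨ 35 ∣ 12345 ⟩ ∷ ⟨ 13 ∣ 12346 ⟩ ∷ ⟨ 23 ∣ 12346 ⟩ ∷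
  ⟨ 34 ∣ 12346 ⟩ ∷ ⟨ 36 ∣ 12346 ⟩ ∷ ⟨ 13 ∣ 12347 ⟩ ∷ ⟨ 23 ∣ 12347 ⟩ ∷ ⟨ 34 ∣ 12347 ⟩ ∷ ⟨ 37 ∣ 12347 ⟩ ∷
  ⟨ 12 ∣ 12348 ⟩ ∷ ⟨ 13 ∣ 12348 ⟩ ∷ ⟨ 14 ∣ 12348 ⟩ ∷ ⟨ 18 ∣ 12348 ⟩ ∷ ⟨ 23 ∣ 12348 ⟩ ∷ ⟨ 24 ∣ 12348 ⟩ ∷
  ⟨ 28 ∣ 12348 ⟩ ∷ ⟨ 34 ∣ 12348 ⟩ ∷ ⟨ 38 ∣ 12348 ⟩ ∷ ⟨ 48 ∣ 12348 ⟩ ∷ ⟨ 13 ∣ 12356 ⟩ ∷ ⟨ 23 ∣ 12356 ⟩ ∷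
  ⟨ 35 ∣ 12356 ⟩ ∷ ⟨ 36 ∣ 12356 ⟩ ∷ ⟨ 13 ∣ 12357 ⟩ ∷ ⟨ 23 ∣ 12357 ⟩ ∷ ⟨ 35 ∣ 12357 ⟩ ∷ ⟨ 37 ∣ 12357 ⟩ ∷
  ⟨ 13 ∣ 12358 ⟩ ∷ ⟨ 18 ∣ 12358 ⟩ ∷ ⟨ 23 ∣ 12358 ⟩ ∷ ⟨ 28 ∣ 12358 ⟩ ∷ ⟨ 35 ∣ 12358 ⟩ ∷ ⟨ 38 ∣ 12358 ⟩ ∷
  ⟨ 58 ∣ 12358 ⟩ ∷ ⟨ 13 ∣ 12367 ⟩ ∷ ⟨ 23 ∣ 12367 ⟩ ∷ ⟨ 36 ∣ 12367 ⟩ ∷ ⟨ 37 ∣ 12367 ⟩ ∷ ⟨ 12 ∣ 12368 ⟩ ∷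
  ⟨ 13 ∣ 12368 ⟩ ∷ ⟨ 16 ∣ 12368 ⟩ ∷ ⟨ 18 ∣ 12368 ⟩ ∷ ⟨ 23 ∣ 12368 ⟩ ∷ ⟨ 26 ∣ 12368 ⟩ ∷ ⟨ 28 ∣ 12368 ⟩ ∷
  ⟨ 36 ∣ 12368 ⟩ ∷ ⟨ 38 ∣ 12368 ⟩ ∷ ⟨ 68 ∣ 12368 ⟩ ∷ ⟨ 13 ∣ 12378 ⟩ ∷ ⟨ 18 ∣ 12378 ⟩ ∷ ⟨ 23 ∣ 12378 ⟩ ∷
  ⟨ 28 ∣ 12378 ⟩ ∷ ⟨ 37 ∣ 12378 ⟩ ∷ ⟨ 38 ∣ 12378 ⟩ ∷ ⟨ 78 ∣ 12378 ⟩ ∷ ⟨ 13 ∣ 13456 ⟩ ∷ ⟨ 34 ∣ 13456 ⟩ ∷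
  ⟨ 35 ∣ 13456 ⟩ ∷ ⟨ 36 ∣ 13456 ⟩ ∷ ⟨ 13 ∣ 13457 ⟩ ∷ ⟨ 34 ∣ 13457 ⟩ ∷ ⟨ 35 ∣ 13457 ⟩ ∷ ⟨ 37 ∣ 13457 ⟩ ∷
  ⟨ 13 ∣ 13458 ⟩ ∷ ⟨ 14 ∣ 13458 ⟩ ∷ ⟨ 15 ∣ 13458 ⟩ ∷ ⟨ 18 ∣ 13458 ⟩ ∷ ⟨ 34 ∣ 13458 ⟩ ∷ ⟨ 35 ∣ 13458 ⟩ ∷
  ⟨ 38 ∣ 13458 ⟩ ∷ ⟨ 45 ∣ 13458 ⟩ ∷ ⟨ 48 ∣ 13458 ⟩ ∷ ⟨ 58 ∣ 13458 ⟩ ∷ ⟨ 13 ∣ 13467 ⟩ ∷ ⟨ 34 ∣ 13467 ⟩ ∷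
  ⟨ 36 ∣ 13467 ⟩ ∷ ⟨ 37 ∣ 13467 ⟩ ∷ ⟨ 13 ∣ 13468 ⟩ ∷ ⟨ 14 ∣ 13468 ⟩ ∷ ⟨ 16 ∣ 13468 ⟩ ∷ ⟨ 18 ∣ 13468 ⟩ ∷
  ⟨ 34 ∣ 13468 ⟩ ∷ ⟨ 36 ∣ 13468 ⟩ ∷ ⟨ 38 ∣ 13468 ⟩ ∷ ⟨ 46 ∣ 13468 ⟩ ∷ ⟨ 48 ∣ 13468 ⟩ ∷ ⟨ 68 ∣ 13468 ⟩ ∷
  ⟨ 13 ∣ 13478 ⟩ ∷ ⟨ 14 ∣ 13478 ⟩ ∷ ⟨ 17 ∣ 13478 ⟩ ∷ ⟨ 18 ∣ 13478 ⟩ ∷ ⟨ 34 ∣ 13478 ⟩ ∷ ⟨ 37 ∣ 13478 ⟩ ∷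
  ⟨ 38 ∣ 13478 ⟩ ∷ ⟨ 47 ∣ 13478 ⟩ ∷ ⟨ 48 ∣ 13478 ⟩ ∷ ⟨ 78 ∣ 13478 ⟩ ∷ ⟨ 13 ∣ 13567 ⟩ ∷ ⟨ 35 ∣ 13567 ⟩ ∷
  ⟨ 36 ∣ 13567 ⟩ ∷ ⟨ 37 ∣ 13567 ⟩ ∷ ⟨ 13 ∣ 13568 ⟩ ∷ ⟨ 15 ∣ 13568 ⟩ ∷ ⟨ 16 ∣ 13568 ⟩ ∷ ⟨ 18 ∣ 13568 ⟩ ∷
  ⟨ 35 ∣ 13568 ⟩ ∷ ⟨ 36 ∣ 13568 ⟩ ∷ ⟨ 38 ∣ 13568 ⟩ ∷ ⟨ 56 ∣ 13568 ⟩ ∷ ⟨ 58 ∣ 13568 ⟩ ∷ ⟨ 68 ∣ 13568 ⟩ ∷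
  ⟨ 13 ∣ 13578 ⟩ ∷ ⟨ 15 ∣ 13578 ⟩ ∷ ⟨ 17 ∣ 13578 ⟩ ∷ ⟨ 18 ∣ 13578 ⟩ ∷ ⟨ 35 ∣ 13578 ⟩ ∷ ⟨ 37 ∣ 13578 ⟩ ∷
  ⟨ 38 ∣ 13578 ⟩ ∷ ⟨ 57 ∣ 13578 ⟩ ∷ ⟨ 58 ∣ 13578 ⟩ ∷ ⟨ 78 ∣ 13578 ⟩ ∷ ⟨ 13 ∣ 13678 ⟩ ∷ ⟨ 18 ∣ 13678 ⟩ ∷
  ⟨ 36 ∣ 13678 ⟩ ∷ ⟨ 37 ∣ 13678 ⟩ ∷ ⟨ 38 ∣ 13678 ⟩ ∷ ⟨ 68 ∣ 13678 ⟩ ∷ ⟨ 78 ∣ 13678 ⟩ ∷ ⟨ 23 ∣ 23456 ⟩ ∷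
  ⟨ 34 ∣ 23456 ⟩ ∷ ⟨ 35 ∣ 23456 ⟩ ∷ ⟨ 36 ∣ 23456 ⟩ ∷ ⟨ 23 ∣ 23457 ⟩ ∷ ⟨ 34 ∣ 23457 ⟩ ∷ ⟨ 35 ∣ 23457 ⟩ ∷
  ⟨ 37 ∣ 23457 ⟩ ∷ ⟨ 23 ∣ 23458 ⟩ ∷ ⟨ 24 ∣ 23458 ⟩ ∷ ⟨ 25 ∣ 23458 ⟩ ∷ ⟨ 28 ∣ 23458 ⟩ ∷ ⟨ 34 ∣ 23458 ⟩ ∷
  ⟨ 35 ∣ 23458 ⟩ ∷ ⟨ 38 ∣ 23458 ⟩ ∷ ⟨ 45 ∣ 23458 ⟩ ∷ ⟨ 48 ∣ 23458 ⟩ ∷ ⟨ 58 ∣ 23458 ⟩ ∷ ⟨ 23 ∣ 23467 ⟩ ∷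
  ⟨ 34 ∣ 23467 ⟩ ∷ ⟨ 36 ∣ 23467 ⟩ ∷ ⟨ 37 ∣ 23467 ⟩ ∷ ⟨ 23 ∣ 23468 ⟩ ∷ ⟨ 28 ∣ 23468 ⟩ ∷ ⟨ 34 ∣ 23468 ⟩ ∷
  ⟨ 36 ∣ 23468 ⟩ ∷ ⟨ 38 ∣ 23468 ⟩ ∷ ⟨ 48 ∣ 23468 ⟩ ∷ ⟨ 68 ∣ 23468 ⟩ ∷ ⟨ 23 ∣ 23478 ⟩ ∷ ⟨ 28 ∣ 23478 ⟩ ∷
  ⟨ 34 ∣ 23478 ⟩ ∷ ⟨ 37 ∣ 23478 ⟩ ∷ ⟨ 38 ∣ 23478 ⟩ ∷ ⟨ 48 ∣ 23478 ⟩ ∷ ⟨ 78 ∣ 23478 ⟩ ∷ ⟨ 23 ∣ 23567 ⟩ ∷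
  ⟨ 35 ∣ 23567 ⟩ ∷ ⟨ 36 ∣ 23567 ⟩ ∷ ⟨ 37 ∣ 23567 ⟩ ∷ ⟨ 23 ∣ 23568 ⟩ ∷ ⟨ 28 ∣ 23568 ⟩ ∷ ⟨ 35 ∣ 23568 ⟩ ∷
  ⟨ 36 ∣ 23568 ⟩ ∷ ⟨ 38 ∣ 23568 ⟩ ∷ ⟨ 58 ∣ 23568 ⟩ ∷ ⟨ 68 ∣ 23568 ⟩ ∷ ⟨ 23 ∣ 23578 ⟩ ∷ ⟨ 28 ∣ 23578 ⟩ ∷
  ⟨ 35 ∣ 23578 ⟩ ∷ ⟨ 37 ∣ 23578 ⟩ ∷ ⟨ 38 ∣ 23578 ⟩ ∷ ⟨ 58 ∣ 23578 ⟩ ∷ ⟨ 78 ∣ 23578 ⟩ ∷ ⟨ 23 ∣ 23678 ⟩ ∷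
  ⟨ 28 ∣ 23678 ⟩ ∷ ⟨ 36 ∣ 23678 ⟩ ∷ ⟨ 37 ∣ 23678 ⟩ ∷ ⟨ 38 ∣ 23678 ⟩ ∷ ⟨ 68 ∣ 23678 ⟩ ∷ ⟨ 78 ∣ 23678 ⟩ ∷
  ⟨ 34 ∣ 34567 ⟩ ∷ ⟨ 35 ∣ 34567 ⟩ ∷ ⟨ 36 ∣ 34567 ⟩ ∷ ⟨ 37 ∣ 34567 ⟩ ∷ ⟨ 34 ∣ 34568 ⟩ ∷ ⟨ 35 ∣ 34568 ⟩ ∷
  ⟨ 36 ∣ 34568 ⟩ ∷ ⟨ 38 ∣ 34568 ⟩ ∷ ⟨ 45 ∣ 34568 ⟩ ∷ ⟨ 46 ∣ 34568 ⟩ ∷ ⟨ 48 ∣ 34568 ⟩ ∷ ⟨ 56 ∣ 34568 ⟩ ∷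
  ⟨ 58 ∣ 34568 ⟩ ∷ ⟨ 68 ∣ 34568 ⟩ ∷ ⟨ 34 ∣ 34578 ⟩ ∷ ⟨ 35 ∣ 34578 ⟩ ∷ ⟨ 37 ∣ 34578 ⟩ ∷ ⟨ 38 ∣ 34578 ⟩ ∷
  ⟨ 48 ∣ 34578 ⟩ ∷ ⟨ 58 ∣ 34578 ⟩ ∷ ⟨ 78 ∣ 34578 ⟩ ∷ ⟨ 34 ∣ 34678 ⟩ ∷ ⟨ 36 ∣ 34678 ⟩ ∷ ⟨ 37 ∣ 34678 ⟩ ∷
  ⟨ 38 ∣ 34678 ⟩ ∷ ⟨ 46 ∣ 34678 ⟩ ∷ ⟨ 47 ∣ 34678 ⟩ ∷ ⟨ 48 ∣ 34678 ⟩ ∷ ⟨ 67 ∣ 34678 ⟩ ∷ ⟨ 68 ∣ 34678 ⟩ ∷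
  ⟨ 78 ∣ 34678 ⟩ ∷ ⟨ 35 ∣ 35678 ⟩ ∷ ⟨ 36 ∣ 35678 ⟩ ∷ ⟨ 37 ∣ 35678 ⟩ ∷ ⟨ 38 ∣ 35678 ⟩ ∷ ⟨ 58 ∣ 35678 ⟩ ∷
  ⟨ 68 ∣ 35678 ⟩ ∷ ⟨ 78 ∣ 35678 ⟩ ∷
  []

independentSet-independent : IsIndependent independentSet
independentSet-independent =
  all-isYes⇒All isVertex? independentSet _ ,
  from-yes (unique? independentSet) ,
  λ u∈ v∈ _ → All.lookup nonadjacent (∈-cartesianProduct⁺ u∈ v∈)
  where
  nonadjacent : All (λ (u , v) → ¬ Adjacent u v) (cartesianProduct independentSet independentSet)
  nonadjacent = all-isYes⇒All (λ (u , v) → ¬? (adjacent? u v)) (cartesianProduct independentSet independentSet) _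

rotate : S8 → S8
rotate (x₁ ∷ x₂ ∷ x₃ ∷ x₄ ∷ x₅ ∷ xs) = x₅ ∷ x₁ ∷ x₂ ∷ x₃ ∷ x₄ ∷ xs

rotateVertex : Pair → Pair
rotateVertex (A , B) = rotate A , rotate B

baseCycles : List (List Pair)
baseCycles =
  (⟨ 14 ∣ 12458 ⟩ ∷ ⟨ 67 ∣ 23678 ⟩ ∷ ⟨ 45 ∣ 13458 ⟩ ∷ ⟨ 26 ∣ 12678 ⟩ ∷ ⟨ 35 ∣ 34578 ⟩ ∷ ⟨ 12 ∣ 12468 ⟩ ∷ ⟨ 37 ∣ 35678 ⟩ ∷ []) ∷
  (⟨ 58 ∣ 12358 ⟩ ∷ ⟨ 47 ∣ 12467 ⟩ ∷ ⟨ 35 ∣ 13568 ⟩ ∷ ⟨ 27 ∣ 12478 ⟩ ∷ ⟨ 36 ∣ 13456 ⟩ ∷ ⟨ 28 ∣ 12578 ⟩ ∷ ⟨ 46 ∣ 13467 ⟩ ∷ []) ∷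
  (⟨ 46 ∣ 12468 ⟩ ∷ ⟨ 35 ∣ 13578 ⟩ ∷ ⟨ 26 ∣ 24678 ⟩ ∷ ⟨ 13 ∣ 13458 ⟩ ∷ ⟨ 27 ∣ 25678 ⟩ ∷ ⟨ 14 ∣ 13468 ⟩ ∷ ⟨ 57 ∣ 23578 ⟩ ∷ []) ∷
  (⟨ 58 ∣ 12578 ⟩ ∷ ⟨ 36 ∣ 13467 ⟩ ∷ ⟨ 28 ∣ 24578 ⟩ ∷ ⟨ 13 ∣ 13567 ⟩ ∷ ⟨ 24 ∣ 24678 ⟩ ∷ ⟨ 15 ∣ 13578 ⟩ ∷ ⟨ 46 ∣ 23467 ⟩ ∷ []) ∷
  (⟨ 16 ∣ 12367 ⟩ ∷ ⟨ 48 ∣ 24578 ⟩ ∷ ⟨ 36 ∣ 13567 ⟩ ∷ ⟨ 28 ∣ 12478 ⟩ ∷ ⟨ 35 ∣ 34567 ⟩ ∷ ⟨ 12 ∣ 12678 ⟩ ∷ ⟨ 45 ∣ 34578 ⟩ ∷ []) ∷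
  (⟨ 38 ∣ 12358 ⟩ ∷ ⟨ 67 ∣ 12467 ⟩ ∷ ⟨ 35 ∣ 23458 ⟩ ∷ ⟨ 16 ∣ 12678 ⟩ ∷ ⟨ 45 ∣ 23457 ⟩ ∷ ⟨ 18 ∣ 12368 ⟩ ∷ ⟨ 47 ∣ 24567 ⟩ ∷ []) ∷
  (⟨ 16 ∣ 12567 ⟩ ∷ ⟨ 38 ∣ 23458 ⟩ ∷ ⟨ 17 ∣ 14567 ⟩ ∷ ⟨ 28 ∣ 23568 ⟩ ∷ ⟨ 47 ∣ 13457 ⟩ ∷ ⟨ 26 ∣ 12568 ⟩ ∷ ⟨ 34 ∣ 34578 ⟩ ∷ []) ∷
  (⟨ 38 ∣ 12348 ⟩ ∷ ⟨ 67 ∣ 14567 ⟩ ∷ ⟨ 23 ∣ 23458 ⟩ ∷ ⟨ 16 ∣ 14678 ⟩ ∷ ⟨ 25 ∣ 23457 ⟩ ∷ ⟨ 18 ∣ 13468 ⟩ ∷ ⟨ 57 ∣ 24567 ⟩ ∷ []) ∷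
  (⟨ 57 ∣ 12357 ⟩ ∷ ⟨ 48 ∣ 13468 ⟩ ∷ ⟨ 25 ∣ 23567 ⟩ ∷ ⟨ 14 ∣ 13478 ⟩ ∷ ⟨ 26 ∣ 23568 ⟩ ∷ ⟨ 17 ∣ 13457 ⟩ ∷ ⟨ 68 ∣ 23468 ⟩ ∷ []) ∷
  (⟨ 12 ∣ 12346 ⟩ ∷ ⟨ 57 ∣ 34578 ⟩ ∷ ⟨ 16 ∣ 12368 ⟩ ∷ ⟨ 47 ∣ 23457 ⟩ ∷ ⟨ 68 ∣ 13568 ⟩ ∷ ⟨ 24 ∣ 12347 ⟩ ∷ ⟨ 58 ∣ 35678 ⟩ ∷ []) ∷
  (⟨ 14 ∣ 12346 ⟩ ∷ ⟨ 58 ∣ 25678 ⟩ ∷ ⟨ 34 ∣ 13467 ⟩ ∷ ⟨ 25 ∣ 12568 ⟩ ∷ ⟨ 37 ∣ 34678 ⟩ ∷ ⟨ 12 ∣ 12456 ⟩ ∷ ⟨ 78 ∣ 35678 ⟩ ∷ []) ∷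
  (⟨ 46 ∣ 12346 ⟩ ∷ ⟨ 57 ∣ 12578 ⟩ ∷ ⟨ 36 ∣ 23468 ⟩ ∷ ⟨ 15 ∣ 12457 ⟩ ∷ ⟨ 38 ∣ 23678 ⟩ ∷ ⟨ 14 ∣ 12456 ⟩ ∷ ⟨ 78 ∣ 23578 ⟩ ∷ []) ∷
  (⟨ 35 ∣ 12345 ⟩ ∷ ⟨ 68 ∣ 14678 ⟩ ∷ ⟨ 23 ∣ 23457 ⟩ ∷ ⟨ 18 ∣ 14568 ⟩ ∷ ⟨ 27 ∣ 23467 ⟩ ∷ ⟨ 15 ∣ 13458 ⟩ ∷ ⟨ 67 ∣ 24678 ⟩ ∷ []) ∷
  (⟨ 17 ∣ 12567 ⟩ ∷ ⟨ 38 ∣ 23468 ⟩ ∷ ⟨ 15 ∣ 14567 ⟩ ∷ ⟨ 28 ∣ 23678 ⟩ ∷ ⟨ 45 ∣ 13456 ⟩ ∷ ⟨ 27 ∣ 12678 ⟩ ∷ ⟨ 34 ∣ 34568 ⟩ ∷ []) ∷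
  (⟨ 26 ∣ 12356 ⟩ ∷ ⟨ 78 ∣ 14578 ⟩ ∷ ⟨ 36 ∣ 23456 ⟩ ∷ ⟨ 18 ∣ 12578 ⟩ ∷ ⟨ 34 ∣ 34567 ⟩ ∷ ⟨ 12 ∣ 12568 ⟩ ∷ ⟨ 47 ∣ 34578 ⟩ ∷ []) ∷
  (⟨ 15 ∣ 12345 ⟩ ∷ ⟨ 78 ∣ 23678 ⟩ ∷ ⟨ 14 ∣ 13456 ⟩ ∷ ⟨ 27 ∣ 23578 ⟩ ∷ ⟨ 46 ∣ 13468 ⟩ ∷ ⟨ 25 ∣ 12357 ⟩ ∷ ⟨ 68 ∣ 34678 ⟩ ∷ []) ∷
  []

cycleCover : List (List Pair)
cycleCover = concatMap (λ c → iterate (map rotateVertex) c 5) baseCycles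

cycleCover-cycles : All (λ c → Cycle Adjacent c × length c ≤ 7) cycleCover
cycleCover-cycles = all-isYes⇒All (λ c → linked? adjacent? (c ++ take 1 c) ×-dec length c ≤? 7) cycleCover _

vertices : List Pair
vertices = filter isVertex? (cartesianProduct (allSubsets 8) (allSubsets 8))

vertex∈cycleCover : ∀ {v} → IsVertex v → v ∈ concat cycleCover
vertex∈cycleCover {A , B} v-vertex = All.lookup vertices-covered
  (∈-filter⁺ isVertex? (∈-cartesianProduct⁺ (∈-allSubsets A) (∈-allSubsets B)) v-vertex)
  where
  vertices-covered : All (_∈ concat cycleCover) vertices
  vertices-covered = all-isYes⇒All (_∈? concat cycleCover) vertices _

independent⇒length≤240 : ∀ S → IsIndependent S → length S ≤ 240
independent⇒length≤240 S (S-vertices , unique , nonadjacent) = begin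
  length S                                     ≤⟨ unique⊆⇒length≤ unique S⊆cover∩S ⟩
  length (filter (_∈? S) (concat cycleCover))  ≤⟨ count-cycles {k = 3} cycleCover-cycles ⟩
  length cycleCover * 3                        ∎
  where
  open ≤-Reasoning
  independent : ∀ {u v} → Adjacent u v → u ∈ S → v ∉ S
  independent u~v u∈S v∈S =
    nonadjacent u∈S v∈S (λ { refl → adjacent-irrefl (All.lookup S-vertices u∈S) u~v }) u~v
  open OddCycles Adjacent (_∈? S) independent
  S⊆cover∩S : S ⊆ filter (_∈? S) (concat cycleCover)
  S⊆cover∩S v∈S = ∈-filter⁺ (_∈? S) (vertex∈cycleCover (All.lookup S-vertices v∈S)) v∈S

mainTheorem12 :
    (Σ (List Pair) (λ S → IsIndependent S × 230 ≤ length S))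
    × (∀ (S : List Pair) → IsIndependent S → length S ≤ 240)
mainTheorem12 = (independentSet , independentSet-independent , ≤-refl) , independent⇒length≤240
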